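{- Let $k\ge 1$ and $m\ge 0$ be integers such that $2^{m+\nu_2(k)}>k$. Then the smallest integer $n\ge k$ such that $\binom{n}{k}$ is divisible by $2^m$ is $n=2^{m+\nu_2(k)}$.
   Context: $\nu_2(x)$ denotes the 2-adic valuation of a positive integer $x$, i.e. the exponent of the largest power of $2$ dividing $x$. -}

module Defs where

open import Data.Nat using (ℕ; suc; _^_; _≤_)
open import Data.Nat.Divisibility using (_∣_)
open import Data.Product using (_×_)
open import Relation.Nullary using (¬_)

Is2AdicValuation : ℕ → ℕ → Set
Is2AdicValuation x v = (2 ^ v ∣ x) × ¬ (2 ^ suc v ∣ x)

IsLeast : (ℕ → Set) → ℕ → Set
IsLeast P n = P n × (∀ n′ → P n′ → n ≤ n′)

-- Legendre's formula ν₂(n!) = Σ_{i≥1} ⌊n/2^i⌋ makes ν₂(n C k) the number of carries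
-- when k and n − k are added in base 2. If 2^v ∣ k no carry arises in the lowest v
-- positions, and if n < 2^(m+v) none leaves position m+v−1, so there are fewer than m
-- carries and 2^m ∤ n C k. Conversely k · (N C k) = N · ((N−1) C (k−1)) with
-- N = 2^(m+v) and k = 2^v · odd gives 2^m ∣ N C k.
module Submission where

open import Defs
open import Data.Nat
open import Data.Nat.Properties
open import Data.Nat.Divisibility
open import Data.Nat.DivMod using (m/n*n≡m)
open import Data.Nat.Combinatorics using (_C_; nCk≡n!/k![n-k]!; k![n∸k]!∣n!; k>n⇒nCk≡0)
open import Data.Nat.Primality using (euclidsLemma; prime[2])
open import Data.Nat.Tactic.RingSolver using (solve-∀)
open import Data.Product using (∃-syntax; _×_; _,_; proj₁)
open import Data.Sum as Sum using (_⊎_; inj₁; inj₂; [_,_])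
open import Data.Empty
open import Relation.Nullary
open import Relation.Binary.PropositionalEquality using (_≡_; refl; sym; trans; cong; cong₂; subst; subst₂; module ≡-Reasoning)

Odd : ℕ → Set
Odd n = ¬ (2 ∣ n)

Odd-1+2* : ∀ h → Odd (1 + 2 * h)
Odd-1+2* h 2∣1+2h with ∣1⇒≡1 (∣m+n∣m⇒∣n (subst (2 ∣_) (+-comm 1 (2 * h)) 2∣1+2h) (m∣m*n h))
... | ()

Odd-2+ : ∀ {n} → Odd n → Odd (2 + n)
Odd-2+ odd-n 2∣2+n = odd-n (∣m+n∣m⇒∣n 2∣2+n ∣-refl)

Odd-* : ∀ {m n} → Odd m → Odd n → Odd (m * n)
Odd-* {m} {n} odd-m odd-n 2∣mn = [ odd-m , odd-n ] (euclidsLemma m n prime[2] 2∣mn)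

Odd∧2^∣*⇒2^∣ : ∀ e {o x} → Odd o → 2 ^ e ∣ o * x → 2 ^ e ∣ x
Odd∧2^∣*⇒2^∣ zero          _     _       = 1∣ _
Odd∧2^∣*⇒2^∣ (suc e) {o} {x} odd-o 2^1+e∣ox
  with euclidsLemma o x prime[2] (∣-trans (m∣m*n (2 ^ e)) 2^1+e∣ox)
... | inj₁ 2∣o        = ⊥-elim (odd-o 2∣o)
... | inj₂ (divides y refl) =
  subst (2 ^ suc e ∣_) (*-comm 2 y) (*-monoʳ-∣ 2 (Odd∧2^∣*⇒2^∣ e odd-o 2^e∣oy))
  where
  2^e∣oy : 2 ^ e ∣ o * y
  2^e∣oy = *-cancelˡ-∣ 2 (subst (2 ^ suc e ∣_) (reassoc o y) 2^1+e∣ox)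
    where
    reassoc : ∀ o y → o * (y * 2) ≡ 2 * (o * y)
    reassoc = solve-∀

^-monoʳ-∣ : ∀ b {e d} → e ≤ d → b ^ e ∣ b ^ d
^-monoʳ-∣ b {e} {d} e≤d = divides (b ^ (d ∸ e)) (begin
  b ^ d               ≡⟨ cong (b ^_) (m+[n∸m]≡n e≤d) ⟨
  b ^ (e + (d ∸ e))   ≡⟨ ^-distribˡ-+-* b e (d ∸ e) ⟩
  b ^ e * b ^ (d ∸ e) ≡⟨ *-comm (b ^ e) _ ⟩
  b ^ (d ∸ e) * b ^ e ∎)
  where open ≡-Reasoning

infix 4 _≡2^_·odd

data _≡2^_·odd (x e : ℕ) : Set where
  oddCofactor : ∀ o → Odd o → x ≡ 2 ^ e * o → x ≡2^ e ·odd

≡2^·odd⇒2^∣ : ∀ {x e} → x ≡2^ e ·odd → 2 ^ e ∣ x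
≡2^·odd⇒2^∣ (oddCofactor o _ refl) = m∣m*n o

≡2^·odd-* : ∀ {x y e f} → x ≡2^ e ·odd → y ≡2^ f ·odd → x * y ≡2^ e + f ·odd
≡2^·odd-* {e = e} {f} (oddCofactor o₁ odd-o₁ refl) (oddCofactor o₂ odd-o₂ refl) =
  oddCofactor (o₁ * o₂) (Odd-* odd-o₁ odd-o₂) (begin
    2 ^ e * o₁ * (2 ^ f * o₂)   ≡⟨ interchange (2 ^ e) o₁ (2 ^ f) o₂ ⟩
    2 ^ e * 2 ^ f * (o₁ * o₂)   ≡⟨ cong (_* (o₁ * o₂)) (^-distribˡ-+-* 2 e f) ⟨
    2 ^ (e + f) * (o₁ * o₂)     ∎)
  where
  open ≡-Reasoning
  interchange : ∀ a b c d → a * b * (c * d) ≡ a * c * (b * d)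
  interchange = solve-∀

2^∣∧≡2^·odd⇒≤ : ∀ {x d e} → 2 ^ d ∣ x → x ≡2^ e ·odd → d ≤ e
2^∣∧≡2^·odd⇒≤ {d = d} {e} 2^d∣x (oddCofactor o odd-o refl) with d ≤? e
... | yes d≤e = d≤e
... | no  d≰e = ⊥-elim (odd-o (*-cancelˡ-∣ (2 ^ e) {{m^n≢0 2 e}} 2^e*2∣2^e*o))
  where
  2^e*2∣2^e*o : 2 ^ e * 2 ∣ 2 ^ e * o
  2^e*2∣2^e*o = subst (_∣ 2 ^ e * o) (*-comm 2 (2 ^ e)) (∣-trans (^-monoʳ-∣ 2 (≰⇒> d≰e)) 2^d∣x)

⌊n/2⌋-parity : ∀ n → n ≡ 2 * ⌊ n /2⌋ ⊎ n ≡ 1 + 2 * ⌊ n /2⌋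
⌊n/2⌋-parity 0 = inj₁ refl
⌊n/2⌋-parity 1 = inj₂ refl
⌊n/2⌋-parity (suc (suc n)) =
  Sum.map (step 0) (step 1) (⌊n/2⌋-parity n)
  where
  2+[d+2h]≡d+2[1+h] : ∀ d h → 2 + (d + 2 * h) ≡ d + 2 * suc h
  2+[d+2h]≡d+2[1+h] = solve-∀
  step : ∀ d → n ≡ d + 2 * ⌊ n /2⌋ → 2 + n ≡ d + 2 * suc ⌊ n /2⌋
  step d eq = trans (cong (2 +_) eq) (2+[d+2h]≡d+2[1+h] d ⌊ n /2⌋)

2*⌊n/2⌋≤n : ∀ n → 2 * ⌊ n /2⌋ ≤ n
2*⌊n/2⌋≤n n with ⌊n/2⌋-parity n
... | inj₁ even = ≤-reflexive (sym even)
... | inj₂ odd  = ≤-trans (n≤1+n _) (≤-reflexive (sym odd))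

⌊n/2⌋<m : ∀ {n m} → n < 2 * m → ⌊ n /2⌋ < m
⌊n/2⌋<m {n} {m} n<2m = *-cancelˡ-< 2 ⌊ n /2⌋ m (≤-<-trans (2*⌊n/2⌋≤n n) n<2m)

⌊2m+n/2⌋≡m+⌊n/2⌋ : ∀ m n → ⌊ 2 * m + n /2⌋ ≡ m + ⌊ n /2⌋
⌊2m+n/2⌋≡m+⌊n/2⌋ zero    n = refl
⌊2m+n/2⌋≡m+⌊n/2⌋ (suc m) n =
  trans (cong ⌊_/2⌋ (2[1+m]+n≡2+[2m+n] m n)) (cong suc (⌊2m+n/2⌋≡m+⌊n/2⌋ m n))
  where
  2[1+m]+n≡2+[2m+n] : ∀ m n → 2 * suc m + n ≡ 2 + (2 * m + n)
  2[1+m]+n≡2+[2m+n] = solve-∀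

⌊m+n+c/2⌋-carry : ∀ m n c → c ≤ 1 →
  ∃[ c′ ] c′ ≤ 1 × ⌊ m + n + c /2⌋ ≡ ⌊ m /2⌋ + ⌊ n /2⌋ + c′
⌊m+n+c/2⌋-carry 0 0 c c≤1 = _ , ⌊n/2⌋-mono {y = 3} (≤-trans c≤1 (s≤s z≤n)) , refl
⌊m+n+c/2⌋-carry 0 1 c c≤1 = _ , ⌊n/2⌋-mono {y = 3} (s≤s (≤-trans c≤1 (s≤s z≤n))) , refl
⌊m+n+c/2⌋-carry 1 0 c c≤1 = _ , ⌊n/2⌋-mono {y = 3} (s≤s (≤-trans c≤1 (s≤s z≤n))) , refl
⌊m+n+c/2⌋-carry 1 1 c c≤1 = _ , ⌊n/2⌋-mono {y = 3} (s≤s (s≤s c≤1)) , refl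
⌊m+n+c/2⌋-carry (suc (suc m)) n c c≤1 with ⌊m+n+c/2⌋-carry m n c c≤1
... | c′ , c′≤1 , eq = c′ , c′≤1 , cong suc eq
⌊m+n+c/2⌋-carry 0 (suc (suc n)) c c≤1 with ⌊m+n+c/2⌋-carry 0 n c c≤1
... | c′ , c′≤1 , eq = c′ , c′≤1 , cong suc eq
⌊m+n+c/2⌋-carry 1 (suc (suc n)) c c≤1 with ⌊m+n+c/2⌋-carry 1 n c c≤1
... | c′ , c′≤1 , eq = c′ , c′≤1 , cong suc eq

n!≡2^⌊n/2⌋*odd*⌊n/2⌋! : ∀ n → ∃[ o ] Odd o × n ! ≡ 2 ^ ⌊ n /2⌋ * o * ⌊ n /2⌋ !
n!≡2^⌊n/2⌋*odd*⌊n/2⌋! 0 = 1 , Odd-1+2* 0 , refl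
n!≡2^⌊n/2⌋*odd*⌊n/2⌋! 1 = 1 , Odd-1+2* 0 , refl
n!≡2^⌊n/2⌋*odd*⌊n/2⌋! (suc (suc n)) with n!≡2^⌊n/2⌋*odd*⌊n/2⌋! n | ⌊n/2⌋-parity n
... | o , odd-o , n!≡ | inj₁ even =
  (1 + n) * o , Odd-* (subst (λ x → Odd (1 + x)) (sym even) (Odd-1+2* h)) odd-o , (begin
    (2 + n) * ((1 + n) * n !)               ≡⟨ cong₂ (λ x y → (2 + x) * ((1 + n) * y)) even n!≡ ⟩
    (2 + 2 * h) * ((1 + n) * (P * o * F))   ≡⟨ regroup h n P o F ⟩
    2 * P * ((1 + n) * o) * ((1 + h) * F)   ∎)
  where
  open ≡-Reasoning
  h = ⌊ n /2⌋
  P = 2 ^ h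
  F = h !
  regroup : ∀ h n P o F → (2 + 2 * h) * ((1 + n) * (P * o * F)) ≡ 2 * P * ((1 + n) * o) * ((1 + h) * F)
  regroup = solve-∀
... | o , odd-o , n!≡ | inj₂ odd =
  (2 + n) * o , Odd-* (Odd-2+ (subst Odd (sym odd) (Odd-1+2* h))) odd-o , (begin
    (2 + n) * ((1 + n) * n !)               ≡⟨ cong₂ (λ x y → (2 + n) * ((1 + x) * y)) odd n!≡ ⟩
    (2 + n) * ((2 + 2 * h) * (P * o * F))   ≡⟨ regroup h n P o F ⟩
    2 * P * ((2 + n) * o) * ((1 + h) * F)   ∎)
  where
  open ≡-Reasoning
  h = ⌊ n /2⌋
  P = 2 ^ h
  F = h !
  regroup : ∀ h n P o F → (2 + n) * ((2 + 2 * h) * (P * o * F)) ≡ 2 * P * ((2 + n) * o) * ((1 + h) * F)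
  regroup = solve-∀

-- legendre j n = Σ_{i=1}^{j} ⌊n/2^i⌋, which is ν₂(n!) once n < 2^j.
legendre : ℕ → ℕ → ℕ
legendre zero    n = 0
legendre (suc j) n = ⌊ n /2⌋ + legendre j ⌊ n /2⌋

n!≡2^legendre·odd : ∀ j n → n < 2 ^ j → n ! ≡2^ legendre j n ·odd
n!≡2^legendre·odd zero    0       _        = oddCofactor 1 (Odd-1+2* 0) refl
n!≡2^legendre·odd zero    (suc n) (s≤s ())
n!≡2^legendre·odd (suc j) n n<2^[1+j] with n!≡2^⌊n/2⌋*odd*⌊n/2⌋! n
... | o , odd-o , n!≡ =
  subst (_≡2^ legendre (suc j) n ·odd) (sym n!≡)
    (≡2^·odd-* (oddCofactor o odd-o refl) (n!≡2^legendre·odd j ⌊ n /2⌋ (⌊n/2⌋<m n<2^[1+j])))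

legendre-+-carry : ∀ j a b c → c ≤ 1 → a + b + c < 2 ^ suc j →
  legendre (suc j) (a + b + c) ≤ legendre (suc j) a + legendre (suc j) b + j
legendre-+-carry zero a b c _ a+b+c<2 =
  subst (λ x → x + 0 ≤ _) (sym (n<1⇒n≡0 (⌊n/2⌋<m a+b+c<2))) z≤n
legendre-+-carry (suc i) a b c c≤1 a+b+c<2^[2+i] with ⌊m+n+c/2⌋-carry a b c c≤1
... | c′ , c′≤1 , ⌊a+b+c/2⌋≡ = begin
  legendre (2 + i) (a + b + c)      ≡⟨ cong (λ x → x + legendre (suc i) x) ⌊a+b+c/2⌋≡ ⟩
  H + legendre (suc i) H            ≤⟨ +-monoʳ-≤ H carries-below ⟩
  H + (La + Lb + i)                 ≤⟨ +-monoˡ-≤ (La + Lb + i) (+-monoʳ-≤ (ha + hb) c′≤1) ⟩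
  ha + hb + 1 + (La + Lb + i)       ≡⟨ regroup ha hb La Lb i ⟩
  ha + La + (hb + Lb) + suc i       ∎
  where
  open ≤-Reasoning
  ha = ⌊ a /2⌋
  hb = ⌊ b /2⌋
  H  = ha + hb + c′
  La = legendre (suc i) ha
  Lb = legendre (suc i) hb
  carries-below : legendre (suc i) H ≤ La + Lb + i
  carries-below = legendre-+-carry i ha hb c′ c′≤1
    (subst (_< 2 ^ suc i) ⌊a+b+c/2⌋≡ (⌊n/2⌋<m a+b+c<2^[2+i]))
  regroup : ∀ ha hb La Lb i → ha + hb + 1 + (La + Lb + i) ≡ ha + La + (hb + Lb) + suc i
  regroup = solve-∀

2^v∣a⇒legendre-+-≤ : ∀ v j a b → 2 ^ v ∣ a → v < j → a + b < 2 ^ j →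
  legendre j (a + b) + suc v ≤ legendre j a + legendre j b + j
2^v∣a⇒legendre-+-≤ zero (suc i) a b _ _ a+b<2^[1+i] = begin
  legendre (suc i) (a + b) + 1       ≡⟨ +-comm _ 1 ⟩
  suc (legendre (suc i) (a + b))     ≡⟨ cong (λ x → suc (legendre (suc i) x)) (sym (+-identityʳ (a + b))) ⟩
  suc (legendre (suc i) (a + b + 0)) ≤⟨ s≤s (legendre-+-carry i a b 0 z≤n a+b+0<2^[1+i]) ⟩
  suc (La + Lb + i)                  ≡⟨ +-suc (La + Lb) i ⟨
  La + Lb + suc i                    ∎
  where
  open ≤-Reasoning
  La = legendre (suc i) a
  Lb = legendre (suc i) b
  a+b+0<2^[1+i] : a + b + 0 < 2 ^ suc i
  a+b+0<2^[1+i] = subst (_< 2 ^ suc i) (sym (+-identityʳ (a + b))) a+b<2^[1+i]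
2^v∣a⇒legendre-+-≤ (suc v) (suc j) a b (divides q refl) (s≤s v<j) a+b<2^[1+j] = begin
  legendre (suc j) (a + b) + suc (suc v)      ≡⟨ cong (λ x → x + legendre j x + suc (suc v)) ⌊a+b/2⌋≡ ⟩
  H + legendre j H + suc (suc v)              ≡⟨ +-suc-suc H (legendre j H) v ⟩
  H + suc (legendre j H + suc v)              ≤⟨ +-monoʳ-≤ H (s≤s carries-above) ⟩
  H + suc (La′ + Lhb + j)                     ≡⟨ regroup a′ hb La′ Lhb j ⟩
  a′ + La′ + (hb + Lhb) + suc j               ≡⟨ cong (λ x → x + legendre j x + (hb + Lhb) + suc j) ⌊a/2⌋≡ ⟨
  legendre (suc j) a + legendre (suc j) b + suc j ∎
  where
  open ≤-Reasoning
  a′  = q * 2 ^ v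
  hb  = ⌊ b /2⌋
  H   = a′ + hb
  La′ = legendre j a′
  Lhb = legendre j hb
  a≡2a′ : q * 2 ^ suc v ≡ 2 * a′
  a≡2a′ = q*[2p]≡2[q*p] q (2 ^ v)
    where
    q*[2p]≡2[q*p] : ∀ q p → q * (2 * p) ≡ 2 * (q * p)
    q*[2p]≡2[q*p] = solve-∀
  ⌊a+b/2⌋≡ : ⌊ q * 2 ^ suc v + b /2⌋ ≡ H
  ⌊a+b/2⌋≡ = trans (cong (λ x → ⌊ x + b /2⌋) a≡2a′) (⌊2m+n/2⌋≡m+⌊n/2⌋ a′ b)
  ⌊a/2⌋≡ : ⌊ q * 2 ^ suc v /2⌋ ≡ a′
  ⌊a/2⌋≡ = trans (cong ⌊_/2⌋ (trans a≡2a′ (sym (+-identityʳ (2 * a′)))))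
                 (trans (⌊2m+n/2⌋≡m+⌊n/2⌋ a′ 0) (+-identityʳ a′))
  carries-above : legendre j H + suc v ≤ La′ + Lhb + j
  carries-above = 2^v∣a⇒legendre-+-≤ v j a′ hb (divides q refl) v<j
    (subst (_< 2 ^ j) ⌊a+b/2⌋≡ (⌊n/2⌋<m a+b<2^[1+j]))
  +-suc-suc : ∀ x y v → x + y + suc (suc v) ≡ x + suc (y + suc v)
  +-suc-suc = solve-∀
  regroup : ∀ a′ hb La′ Lhb j → a′ + hb + suc (La′ + Lhb + j) ≡ a′ + La′ + (hb + Lhb) + suc j
  regroup = solve-∀

nCk*[k!*[n∸k]!]≡n! : ∀ {n k} → k ≤ n → (n C k) * (k ! * (n ∸ k) !) ≡ n !
nCk*[k!*[n∸k]!]≡n! {n} {k} k≤n =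
  trans (cong (_* (k ! * (n ∸ k) !)) (nCk≡n!/k![n-k]! k≤n))
        (m/n*n≡m {{k !* (n ∸ k) !≢0}} (k![n∸k]!∣n! k≤n))

[1+k]*[1+n]C[1+k]≡[1+n]*nCk : ∀ n k → suc k * (suc n C suc k) ≡ suc n * (n C k)
[1+k]*[1+n]C[1+k]≡[1+n]*nCk n k with k ≤? n
... | no k≰n rewrite k>n⇒nCk≡0 (≰⇒> k≰n) | k>n⇒nCk≡0 (s≤s (≰⇒> k≰n)) =
  trans (*-zeroʳ (suc k)) (sym (*-zeroʳ (suc n)))
... | yes k≤n = *-cancelˡ-≡ _ _ D {{k !* (n ∸ k) !≢0}} (begin
  D * (suc k * C₁)                         ≡⟨ regroup (k !) ((n ∸ k) !) (suc k) C₁ ⟩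
  C₁ * (suc k * k ! * (n ∸ k) !)           ≡⟨ nCk*[k!*[n∸k]!]≡n! (s≤s k≤n) ⟩
  suc n * n !                              ≡⟨ cong (suc n *_) (nCk*[k!*[n∸k]!]≡n! k≤n) ⟨
  suc n * (C₀ * D)                         ≡⟨ rotate (suc n) C₀ D ⟩
  D * (suc n * C₀)                         ∎)
  where
  open ≡-Reasoning
  D  = k ! * (n ∸ k) !
  C₀ = n C k
  C₁ = suc n C suc k
  regroup : ∀ a b c d → a * b * (c * d) ≡ d * (c * a * b)
  regroup = solve-∀
  rotate : ∀ a b c → a * (b * c) ≡ c * (a * b)
  rotate = solve-∀

Is2AdicValuation⇒≡2^·odd : ∀ {x v} → Is2AdicValuation x v → x ≡2^ v ·odd
Is2AdicValuation⇒≡2^·odd {v = v} (divides q x≡q*2^v , 2^[1+v]∤x) =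
  oddCofactor q (λ 2∣q → 2^[1+v]∤x (subst (2 ^ suc v ∣_) (sym x≡q*2^v) (*-monoˡ-∣ (2 ^ v) 2∣q)))
    (trans x≡q*2^v (*-comm q (2 ^ v)))

2^[m+v]∣n⇒2^m∣nCk : ∀ m v {n k} → 2 ^ (m + v) ∣ n → k ≡2^ v ·odd → 2 ^ m ∣ n C k
2^[m+v]∣n⇒2^m∣nCk m v {_} {zero} _ (oddCofactor o odd-o 0≡2^v*o) =
  ⊥-elim (odd-o (subst (2 ∣_) (sym o≡0) (2 ∣0)))
  where
  o≡0 : o ≡ 0
  o≡0 = *-cancelˡ-≡ o 0 (2 ^ v) {{m^n≢0 2 v}} (trans (sym 0≡2^v*o) (sym (*-zeroʳ (2 ^ v))))
2^[m+v]∣n⇒2^m∣nCk m v {zero} {suc k} _ _ = (2 ^ m) ∣0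
2^[m+v]∣n⇒2^m∣nCk m v {suc n} {suc k} (divides r 1+n≡r*2^[m+v]) (oddCofactor o odd-o 1+k≡2^v*o) =
  Odd∧2^∣*⇒2^∣ m odd-o (divides (r * C₀) o*C₁≡)
  where
  open ≡-Reasoning
  C₀ = n C k
  C₁ = suc n C suc k
  regroup : ∀ r a b c → r * (a * b) * c ≡ b * (r * c * a)
  regroup = solve-∀
  o*C₁≡ : o * C₁ ≡ r * C₀ * 2 ^ m
  o*C₁≡ = *-cancelˡ-≡ _ _ (2 ^ v) {{m^n≢0 2 v}} (begin
    2 ^ v * (o * C₁)           ≡⟨ *-assoc (2 ^ v) o C₁ ⟨
    2 ^ v * o * C₁             ≡⟨ cong (_* C₁) 1+k≡2^v*o ⟨
    suc k * C₁                 ≡⟨ [1+k]*[1+n]C[1+k]≡[1+n]*nCk n k ⟩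
    suc n * C₀                 ≡⟨ cong (_* C₀) 1+n≡r*2^[m+v] ⟩
    r * 2 ^ (m + v) * C₀       ≡⟨ cong (λ x → r * x * C₀) (^-distribˡ-+-* 2 m v) ⟩
    r * (2 ^ m * 2 ^ v) * C₀   ≡⟨ regroup r (2 ^ m) (2 ^ v) C₀ ⟩
    2 ^ v * (r * C₀ * 2 ^ m)   ∎)

2^m∣nCk⇒m+legendre≤legendre : ∀ j m {n k} → k ≤ n → n < 2 ^ j → 2 ^ m ∣ n C k →
  m + (legendre j k + legendre j (n ∸ k)) ≤ legendre j n
2^m∣nCk⇒m+legendre≤legendre j m {n} {k} k≤n n<2^j 2^m∣nCk =
  2^∣∧≡2^·odd⇒≤ 2^[m+Lk+Lb]∣n! (n!≡2^legendre·odd j n n<2^j)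
  where
  k!*[n∸k]!≡ : k ! * (n ∸ k) ! ≡2^ legendre j k + legendre j (n ∸ k) ·odd
  k!*[n∸k]!≡ = ≡2^·odd-* (n!≡2^legendre·odd j k (≤-<-trans k≤n n<2^j))
                         (n!≡2^legendre·odd j (n ∸ k) (≤-<-trans (m∸n≤m n k) n<2^j))
  2^[m+Lk+Lb]∣n! : 2 ^ (m + (legendre j k + legendre j (n ∸ k))) ∣ n !
  2^[m+Lk+Lb]∣n! = subst₂ _∣_ (sym (^-distribˡ-+-* 2 m _)) (nCk*[k!*[n∸k]!]≡n! k≤n)
    (*-pres-∣ 2^m∣nCk (≡2^·odd⇒2^∣ k!*[n∸k]!≡))

2^m∣nCk⇒2^[m+v]≤n : ∀ m v {n k} → 1 ≤ k → 2 ^ v ∣ k → k ≤ n → 2 ^ m ∣ n C k → 2 ^ (m + v) ≤ n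
2^m∣nCk⇒2^[m+v]≤n zero v 1≤k 2^v∣k k≤n _ = ≤-trans (∣⇒≤ {{>-nonZero 1≤k}} 2^v∣k) k≤n
2^m∣nCk⇒2^[m+v]≤n m@(suc _) v {n} {k} 1≤k 2^v∣k k≤n 2^m∣nCk with 2 ^ (m + v) ≤? n
... | yes 2^[m+v]≤n = 2^[m+v]≤n
... | no  2^[m+v]≰n = contradiction (+-cancelˡ-≤ (legendre j n) (suc v) v (begin
  legendre j n + suc v              ≡⟨ cong (λ x → legendre j x + suc v) k+[n∸k]≡n ⟨
  legendre j (k + (n ∸ k)) + suc v  ≤⟨ 2^v∣a⇒legendre-+-≤ v j k (n ∸ k) 2^v∣k (m<n+m v z<s) k+[n∸k]<2^j ⟩
  A + j                             ≡⟨ regroup A m v ⟩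
  m + A + v                         ≤⟨ +-monoˡ-≤ v (2^m∣nCk⇒m+legendre≤legendre j m k≤n n<2^j 2^m∣nCk) ⟩
  legendre j n + v                  ∎)) 1+n≰n
  where
  open ≤-Reasoning
  j = m + v
  A = legendre j k + legendre j (n ∸ k)
  n<2^j : n < 2 ^ j
  n<2^j = ≰⇒> 2^[m+v]≰n
  k+[n∸k]≡n : k + (n ∸ k) ≡ n
  k+[n∸k]≡n = m+[n∸m]≡n k≤n
  k+[n∸k]<2^j : k + (n ∸ k) < 2 ^ j
  k+[n∸k]<2^j = subst (_< 2 ^ j) (sym k+[n∸k]≡n) n<2^j
  regroup : ∀ a m v → a + (m + v) ≡ m + a + v
  regroup = solve-∀

mainTheorem1 : (k m v : ℕ) → 1 ≤ k → Is2AdicValuation k v →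
    k < 2 ^ (m + v) →
    IsLeast (λ n → (k ≤ n) × (2 ^ m ∣ n C k)) (2 ^ (m + v))
mainTheorem1 k m v 1≤k ν₂[k]≡v k<2^[m+v] =
  (<⇒≤ k<2^[m+v] , 2^[m+v]∣n⇒2^m∣nCk m v ∣-refl (Is2AdicValuation⇒≡2^·odd ν₂[k]≡v)) ,
  λ n (k≤n , 2^m∣nCk) → 2^m∣nCk⇒2^[m+v]≤n m v 1≤k (proj₁ ν₂[k]≡v) k≤n 2^m∣nCk
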